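{- Let $A$ be a BL-algebra. (1) For every filter $F$ of $A$: if $F$ has ILP, then $F$ has BLP. (2) If $A$ has ILP, then $A$ has BLP.
   Context: A residuated lattice is an algebra $(A,\vee,\wedge,\odot,\to,0,1)$ with $(A,\vee,\wedge,0,1)$ a bounded lattice, $(A,\odot,1)$ a commutative monoid and $a\le b\to c$ iff $a\odot b\le c$; a BL-algebra is a residuated lattice satisfying $a\wedge b=a\odot(a\to b)$ and $(a\to b)\vee(b\to a)=1$. Filters are non-empty subsets closed under $\odot$ and upward closed. For a filter $F$, $A/F$ is the quotient by the congruence $x\sim_F y$ iff $(x\to y)\wedge(y\to x)\in F$, and for $X\subseteq A$, $X/F=\{x/F\mid x\in X\}$. $\mathcal{B}(A)$ is the set of complemented elements of the underlying bounded lattice of $A$; ${\cal I}(A)=\{a\in A\mid a\odot a=a\}$ is the set of idempotents. $F$ has BLP iff $\mathcal{B}(A/F)=\mathcal{B}(A)/F$; $F$ has ILP iff ${\cal I}(A/F)={\cal I}(A)/F$. $A$ has BLP (resp. ILP) iff all its filters have BLP (resp. ILP). -}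

module Defs where

open import Level using (Level; suc; _⊔_)
open import Data.Product using (Σ; _×_; _,_; ∃)
open import Function.Bundles using (_⇔_)
open import Relation.Binary.PropositionalEquality using (_≡_)
open import Algebra.Core using (Op₂)
import Algebra.Structures as AS
import Algebra.Lattice.Structures as ALS

record ResiduatedLattice (a : Level) : Set (suc a) where
  infixr 6 _∨_
  infixr 7 _∧_
  infixr 8 _⊙_
  infixr 5 _⇒_
  field
    Carrier : Set a
    _∨_ _∧_ _⊙_ _⇒_ : Op₂ Carrier
    𝟘 𝟙 : Carrier
    isLattice : ALS.IsLattice {A = Carrier} _≡_ _∨_ _∧_
    ⊙-isCommutativeMonoid : AS.IsCommutativeMonoid {A = Carrier} _≡_ _⊙_ 𝟙

  _≤_ : Carrier → Carrier → Set a
  x ≤ y = x ∧ y ≡ x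

  field
    𝟘-least : ∀ x → 𝟘 ≤ x
    𝟙-greatest : ∀ x → x ≤ 𝟙
    residuation : ∀ x y z → (x ≤ (y ⇒ z)) ⇔ ((x ⊙ y) ≤ z)

record BLAlgebra (a : Level) : Set (suc a) where
  field
    residuatedLattice : ResiduatedLattice a
  open ResiduatedLattice residuatedLattice public
  field
    divisibility : ∀ x y → x ∧ y ≡ x ⊙ (x ⇒ y)
    prelinearity : ∀ x y → (x ⇒ y) ∨ (y ⇒ x) ≡ 𝟙

module _ {a : Level} (A : BLAlgebra a) where
  open BLAlgebra A

  record IsFilter {ℓ : Level} (F : Carrier → Set ℓ) : Set (a ⊔ ℓ) where
    field
      nonempty : ∃ F
      ⊙-closed : ∀ {x y} → F x → F y → F (x ⊙ y)
      up-closed : ∀ {x y} → F x → x ≤ y → F y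

  -- The congruence ∼_F of the quotient A/F:  x/F = y/F  iff  x ∼F y.
  _∼[_]_ : {ℓ : Level} → Carrier → (Carrier → Set ℓ) → Carrier → Set ℓ
  x ∼[ F ] y = F ((x ⇒ y) ∧ (y ⇒ x))

  IsComplemented : Carrier → Set a
  IsComplemented x = Σ Carrier λ y → (x ∨ y ≡ 𝟙) × (x ∧ y ≡ 𝟘)

  IsIdempotent : Carrier → Set a
  IsIdempotent x = x ⊙ x ≡ x

  -- x/F is complemented in A/F (operations of A/F are the induced ones,
  -- equality in A/F is ∼F).
  IsComplementedMod : {ℓ : Level} → (Carrier → Set ℓ) → Carrier → Set (a ⊔ ℓ)
  IsComplementedMod F x =
    Σ Carrier λ y → ((x ∨ y) ∼[ F ] 𝟙) × ((x ∧ y) ∼[ F ] 𝟘)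

  IsIdempotentMod : {ℓ : Level} → (Carrier → Set ℓ) → Carrier → Set ℓ
  IsIdempotentMod F x = (x ⊙ x) ∼[ F ] x

  -- F has BLP:  B(A/F) = B(A)/F, i.e. for every x ∈ A,
  -- x/F ∈ B(A/F)  iff  x/F = e/F for some e ∈ B(A).
  HasBLP : {ℓ : Level} → (Carrier → Set ℓ) → Set (a ⊔ ℓ)
  HasBLP F = ∀ x → IsComplementedMod F x
                 ⇔ (Σ Carrier λ e → IsComplemented e × (x ∼[ F ] e))

  -- F has ILP:  I(A/F) = I(A)/F.
  HasILP : {ℓ : Level} → (Carrier → Set ℓ) → Set (a ⊔ ℓ)
  HasILP F = ∀ x → IsIdempotentMod F x
                 ⇔ (Σ Carrier λ e → IsIdempotent e × (x ∼[ F ] e))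

  AlgHasBLP : (ℓ : Level) → Set (a ⊔ suc ℓ)
  AlgHasBLP ℓ = (F : Carrier → Set ℓ) → IsFilter F → HasBLP F

  AlgHasILP : (ℓ : Level) → Set (a ⊔ suc ℓ)
  AlgHasILP ℓ = (F : Carrier → Set ℓ) → IsFilter F → HasILP F

-- Write ¬ x = x ⇒ 𝟘.  One inclusion of BLP, B(A)/F ⊆ B(A/F), holds for
-- every filter: if x ∼F e and e has complement e', then e' is a complement
-- of x modulo F.  For the other inclusion, let x/F be complemented.  Then
--   (1) the excluded middle x ∨ ¬ x lies in F;
--   (2) hence x/F is idempotent, so by ILP  x ∼F e  for an idempotent e;
--   (3) for idempotent e, ¬¬e is complemented (with complement ¬e) — this
--       is where divisibility and prelinearity of BL-algebras are used;
--   (4) x ∨ ¬ x ∈ F and x ∼F e give x ∼F ¬¬e, the required Boolean lift.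
module Submission where

open import Defs
open import Level using (Level)
open import Data.Product using (_×_; _,_; Σ; proj₂)
open import Function.Bundles using (Equivalence; mk⇔)
open import Relation.Binary.PropositionalEquality
  using (_≡_; refl; sym; cong; isEquivalence)
open import Relation.Binary.Bundles using (Poset)
import Relation.Binary.Lattice as OrderLattice
import Relation.Binary.Reasoning.PartialOrder as PosetReasoning
open import Algebra.Lattice.Bundles using (Lattice)
import Algebra.Lattice.Properties.Lattice as LatticeProperties
import Algebra.Structures as AS

module ResiduatedLatticeFacts {a : Level} (L : ResiduatedLattice a) where
  open ResiduatedLattice L
  open AS.IsCommutativeMonoid ⊙-isCommutativeMonoid
    using () renaming (assoc to ⊙-assoc; comm to ⊙-comm; identityˡ to ⊙-identityˡ;
                       identityʳ to ⊙-identityʳ)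

  -- The library turns the lattice into an order-theoretic lattice for the
  -- order  x ≡ x ∧ y ; ours is its mirror  x ∧ y ≡ x .
  private
    lattice : Lattice a a
    lattice = record { isLattice = isLattice }
    module Mirror = OrderLattice.Lattice
                      (LatticeProperties.∨-∧-orderTheoreticLattice lattice)

  ≤-reflexive : ∀ {x y} → x ≡ y → x ≤ y
  ≤-reflexive x≡y = sym (Mirror.reflexive x≡y)

  ≤-trans : ∀ {x y z} → x ≤ y → y ≤ z → x ≤ z
  ≤-trans x≤y y≤z = sym (Mirror.trans (sym x≤y) (sym y≤z))

  ≤-antisym : ∀ {x y} → x ≤ y → y ≤ x → x ≡ y
  ≤-antisym x≤y y≤x = Mirror.antisym (sym x≤y) (sym y≤x)

  ≤-poset : Poset a a a
  ≤-poset = record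
    { _≈_ = _≡_
    ; _≤_ = _≤_
    ; isPartialOrder = record
      { isPreorder = record
        { isEquivalence = isEquivalence ; reflexive = ≤-reflexive ; trans = ≤-trans }
      ; antisym = ≤-antisym }
    }

  open PosetReasoning ≤-poset public

  ≤-refl : ∀ {x} → x ≤ x
  ≤-refl = ≤-reflexive refl

  x≤x∨y : ∀ {x y} → x ≤ (x ∨ y)
  x≤x∨y {x} {y} = sym (Mirror.x≤x∨y x y)

  y≤x∨y : ∀ {x y} → y ≤ (x ∨ y)
  y≤x∨y {x} {y} = sym (Mirror.y≤x∨y x y)

  ∨-least : ∀ {x y z} → x ≤ z → y ≤ z → (x ∨ y) ≤ z
  ∨-least x≤z y≤z = sym (Mirror.∨-least (sym x≤z) (sym y≤z))

  x∧y≤x : ∀ {x y} → (x ∧ y) ≤ x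
  x∧y≤x {x} {y} = sym (Mirror.x∧y≤x x y)

  x∧y≤y : ∀ {x y} → (x ∧ y) ≤ y
  x∧y≤y {x} {y} = sym (Mirror.x∧y≤y x y)

  ∧-greatest : ∀ {x y z} → x ≤ y → x ≤ z → x ≤ (y ∧ z)
  ∧-greatest x≤y x≤z = sym (Mirror.∧-greatest (sym x≤y) (sym x≤z))

  ≤𝟘⇒≡𝟘 : ∀ {x} → x ≤ 𝟘 → x ≡ 𝟘
  ≤𝟘⇒≡𝟘 x≤𝟘 = ≤-antisym x≤𝟘 (𝟘-least _)

  ⇒-intro : ∀ {x y z} → (x ⊙ y) ≤ z → x ≤ (y ⇒ z)
  ⇒-intro {x} {y} {z} = Equivalence.from (residuation x y z)

  ⇒-elim : ∀ {x y z} → x ≤ (y ⇒ z) → (x ⊙ y) ≤ z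
  ⇒-elim {x} {y} {z} = Equivalence.to (residuation x y z)

  modus-ponens : ∀ {y z} → ((y ⇒ z) ⊙ y) ≤ z
  modus-ponens = ⇒-elim ≤-refl

  ⊙-monoˡ : ∀ {u v z} → u ≤ v → (u ⊙ z) ≤ (v ⊙ z)
  ⊙-monoˡ u≤v = ⇒-elim (≤-trans u≤v (⇒-intro ≤-refl))

  ⊙-monoʳ : ∀ {u v z} → u ≤ v → (z ⊙ u) ≤ (z ⊙ v)
  ⊙-monoʳ {u} {v} {z} u≤v = begin
    z ⊙ u  ≡⟨ ⊙-comm z u ⟩
    u ⊙ z  ≤⟨ ⊙-monoˡ u≤v ⟩
    v ⊙ z  ≡⟨ ⊙-comm v z ⟩
    z ⊙ v  ∎

  x⊙y≤x : ∀ {x y} → (x ⊙ y) ≤ x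
  x⊙y≤x {x} {y} = begin
    x ⊙ y  ≤⟨ ⊙-monoʳ (𝟙-greatest y) ⟩
    x ⊙ 𝟙  ≡⟨ ⊙-identityʳ x ⟩
    x      ∎

  x⊙y≤y : ∀ {x y} → (x ⊙ y) ≤ y
  x⊙y≤y {x} {y} = ≤-trans (≤-reflexive (⊙-comm x y)) x⊙y≤x

  x⊙y≤x∧y : ∀ {x y} → (x ⊙ y) ≤ (x ∧ y)
  x⊙y≤x∧y = ∧-greatest x⊙y≤x x⊙y≤y

  -- Proof by cases on a join: ⊙ distributes over ∨ (because u ⊙ _ is a left
  -- adjoint), so a bound for both cases bounds the join.
  ⊙-∨-cases : ∀ {u v z w} → (u ⊙ z) ≤ w → (v ⊙ z) ≤ w → ((u ∨ v) ⊙ z) ≤ w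
  ⊙-∨-cases uz≤w vz≤w = ⇒-elim (∨-least (⇒-intro uz≤w) (⇒-intro vz≤w))

  ⇒-top : ∀ {u v z} → u ≤ v → z ≤ (u ⇒ v)
  ⇒-top u≤v = ⇒-intro (≤-trans x⊙y≤y u≤v)

  ⇒-monoʳ : ∀ {u v w} → u ≤ v → (w ⇒ u) ≤ (w ⇒ v)
  ⇒-monoʳ u≤v = ⇒-intro (≤-trans modus-ponens u≤v)

  𝟙⇒-elim : ∀ {z} → (𝟙 ⇒ z) ≤ z
  𝟙⇒-elim {z} = ≤-trans (≤-reflexive (sym (⊙-identityʳ (𝟙 ⇒ z)))) modus-ponens

  infixr 25 ¬_
  ¬_ : Carrier → Carrier
  ¬ x = x ⇒ 𝟘

  x⊙¬x≤𝟘 : ∀ {x} → (x ⊙ ¬ x) ≤ 𝟘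
  x⊙¬x≤𝟘 {x} = ≤-trans (≤-reflexive (⊙-comm x (¬ x))) modus-ponens

  x≤¬¬x : ∀ {x} → x ≤ ¬ ¬ x
  x≤¬¬x = ⇒-intro x⊙¬x≤𝟘

  ⊙¬-transfer : ∀ {u v w} → (u ⊙ w) ≤ v → (u ⊙ ¬ v) ≤ ¬ w
  ⊙¬-transfer {u} {v} {w} uw≤v = ⇒-intro (begin
    (u ⊙ ¬ v) ⊙ w  ≡⟨ cong (_⊙ w) (⊙-comm u (¬ v)) ⟩
    (¬ v ⊙ u) ⊙ w  ≡⟨ ⊙-assoc (¬ v) u w ⟩
    ¬ v ⊙ (u ⊙ w)  ≤⟨ ⊙-monoʳ uw≤v ⟩
    ¬ v ⊙ v        ≤⟨ modus-ponens ⟩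
    𝟘              ∎)

  contraposition : ∀ {u v} → ((u ⇒ v) ⊙ ¬ v) ≤ ¬ u
  contraposition = ⊙¬-transfer modus-ponens

  join-𝟙⇒meet≤product : ∀ {u v} → u ∨ v ≡ 𝟙 → (u ∧ v) ≤ (u ⊙ v)
  join-𝟙⇒meet≤product {u} {v} u∨v≡𝟙 = begin
    u ∧ v              ≡⟨ sym (⊙-identityˡ (u ∧ v)) ⟩
    𝟙 ⊙ (u ∧ v)        ≡⟨ cong (_⊙ (u ∧ v)) (sym u∨v≡𝟙) ⟩
    (u ∨ v) ⊙ (u ∧ v)  ≤⟨ ⊙-∨-cases (⊙-monoʳ x∧y≤y)
                                   (≤-trans (⊙-monoʳ x∧y≤x) (≤-reflexive (⊙-comm v u))) ⟩
    u ⊙ v              ∎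

module BLAlgebraFacts {a : Level} (A : BLAlgebra a) where
  open BLAlgebra A
  open ResiduatedLatticeFacts residuatedLattice
  open AS.IsCommutativeMonoid ⊙-isCommutativeMonoid
    using () renaming (assoc to ⊙-assoc; comm to ⊙-comm)

  ¬¬-idempotent-complemented : ∀ {e} → IsIdempotent A e → IsComplemented A (¬ ¬ e)
  ¬¬-idempotent-complemented {e} e⊙e≡e = ¬ e , ¬¬e∨¬e≡𝟙 , ¬¬e∧¬e≡𝟘
    where
    -- idempotence: using e twice is as good as using it once
    e⇒¬e≤¬e : (e ⇒ ¬ e) ≤ ¬ e
    e⇒¬e≤¬e = ⇒-intro (begin
      (e ⇒ ¬ e) ⊙ e        ≡⟨ cong ((e ⇒ ¬ e) ⊙_) (sym e⊙e≡e) ⟩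
      (e ⇒ ¬ e) ⊙ (e ⊙ e)  ≡⟨ sym (⊙-assoc (e ⇒ ¬ e) e e) ⟩
      ((e ⇒ ¬ e) ⊙ e) ⊙ e  ≤⟨ ⊙-monoˡ modus-ponens ⟩
      ¬ e ⊙ e              ≤⟨ modus-ponens ⟩
      𝟘                    ∎)

    -- divisibility turns the meet into a product
    e∧¬e≤𝟘 : (e ∧ ¬ e) ≤ 𝟘
    e∧¬e≤𝟘 = begin
      e ∧ ¬ e        ≡⟨ divisibility e (¬ e) ⟩
      e ⊙ (e ⇒ ¬ e)  ≤⟨ ⊙-monoʳ e⇒¬e≤¬e ⟩
      e ⊙ ¬ e        ≤⟨ x⊙¬x≤𝟘 ⟩
      𝟘              ∎

    ¬e⇒e≤¬¬e : (¬ e ⇒ e) ≤ ¬ ¬ e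
    ¬e⇒e≤¬¬e = ⇒-intro (≤-trans (∧-greatest modus-ponens x⊙y≤y) e∧¬e≤𝟘)

    -- prelinearity supplies the join
    ¬¬e∨¬e≡𝟙 : ¬ ¬ e ∨ ¬ e ≡ 𝟙
    ¬¬e∨¬e≡𝟙 = ≤-antisym (𝟙-greatest _) (begin
      𝟙                        ≡⟨ sym (prelinearity e (¬ e)) ⟩
      (e ⇒ ¬ e) ∨ (¬ e ⇒ e)    ≤⟨ ∨-least (≤-trans e⇒¬e≤¬e y≤x∨y)
                                          (≤-trans ¬e⇒e≤¬¬e x≤x∨y) ⟩
      ¬ ¬ e ∨ ¬ e              ∎)

    ¬¬e∧¬e≡𝟘 : ¬ ¬ e ∧ ¬ e ≡ 𝟘
    ¬¬e∧¬e≡𝟘 = ≤𝟘⇒≡𝟘 (≤-trans (join-𝟙⇒meet≤product ¬¬e∨¬e≡𝟙)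
                             (≤-trans (≤-reflexive (⊙-comm (¬ ¬ e) (¬ e))) x⊙¬x≤𝟘))

module FilterFacts {a ℓ : Level} (A : BLAlgebra a)
                   (F : BLAlgebra.Carrier A → Set ℓ) (isFilter : IsFilter A F) where
  open BLAlgebra A
  open ResiduatedLatticeFacts residuatedLattice
  open BLAlgebraFacts A
  open IsFilter isFilter
  open AS.IsCommutativeMonoid ⊙-isCommutativeMonoid
    using () renaming (assoc to ⊙-assoc; comm to ⊙-comm)

  infix 4 _∼F_
  _∼F_ : Carrier → Carrier → Set ℓ
  x ∼F y = _∼[_]_ A x F y

  𝟙∈F : F 𝟙
  𝟙∈F = up-closed (proj₂ nonempty) (𝟙-greatest _)

  ⇒∈F : ∀ {u v} → u ≤ v → F (u ⇒ v)
  ⇒∈F u≤v = up-closed 𝟙∈F (⇒-top u≤v)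

  ∼-intro : ∀ {x y} → F (x ⇒ y) → F (y ⇒ x) → x ∼F y
  ∼-intro x⇒y∈F y⇒x∈F = up-closed (⊙-closed x⇒y∈F y⇒x∈F) x⊙y≤x∧y

  ∼-elimˡ : ∀ {x y} → x ∼F y → F (x ⇒ y)
  ∼-elimˡ x∼y = up-closed x∼y x∧y≤x

  ∼-elimʳ : ∀ {x y} → x ∼F y → F (y ⇒ x)
  ∼-elimʳ x∼y = up-closed x∼y x∧y≤y

  complemented-lift : ∀ {x e} → IsComplemented A e → x ∼F e → IsComplementedMod A F x
  complemented-lift {x} {e} (e' , e∨e'≡𝟙 , e∧e'≡𝟘) x∼e =
    e' , ∼-intro (⇒∈F (𝟙-greatest _)) (up-closed (∼-elimʳ x∼e) e⇒x≤𝟙⇒x∨e')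
       , ∼-intro (up-closed (∼-elimˡ x∼e) x⇒e≤¬x∧e') (⇒∈F (𝟘-least _))
    where
    e⇒x≤𝟙⇒x∨e' : (e ⇒ x) ≤ (𝟙 ⇒ (x ∨ e'))
    e⇒x≤𝟙⇒x∨e' = ⇒-intro (begin
      (e ⇒ x) ⊙ 𝟙         ≡⟨ ⊙-comm (e ⇒ x) 𝟙 ⟩
      𝟙 ⊙ (e ⇒ x)         ≡⟨ cong (_⊙ (e ⇒ x)) (sym e∨e'≡𝟙) ⟩
      (e ∨ e') ⊙ (e ⇒ x)  ≤⟨ ⊙-∨-cases
                               (≤-trans (≤-reflexive (⊙-comm e (e ⇒ x)))
                                        (≤-trans modus-ponens x≤x∨y))
                               (≤-trans x⊙y≤x y≤x∨y) ⟩
      x ∨ e'              ∎)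

    x⇒e≤¬x∧e' : (x ⇒ e) ≤ (¬ (x ∧ e'))
    x⇒e≤¬x∧e' = ⇒-intro (begin
      (x ⇒ e) ⊙ (x ∧ e')  ≤⟨ ∧-greatest (≤-trans (⊙-monoʳ x∧y≤x) modus-ponens)
                                         (≤-trans x⊙y≤y x∧y≤y) ⟩
      e ∧ e'              ≡⟨ e∧e'≡𝟘 ⟩
      𝟘                   ∎)

  complemented⇒excluded-middle : ∀ {x} → IsComplementedMod A F x → F (x ∨ ¬ x)
  complemented⇒excluded-middle {x} (y , x∨y∼𝟙 , x∧y∼𝟘) =
    up-closed (⊙-closed x∨y∈F ¬x∧y∈F)
              (⊙-∨-cases (≤-trans x⊙y≤x x≤x∨y) (≤-trans y⊙¬x∧y≤¬x y≤x∨y))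
    where
    x∨y∈F : F (x ∨ y)
    x∨y∈F = up-closed (∼-elimʳ x∨y∼𝟙) 𝟙⇒-elim

    ¬x∧y∈F : F (¬ (x ∧ y))
    ¬x∧y∈F = ∼-elimˡ x∧y∼𝟘

    y⊙¬x∧y≤¬x : (y ⊙ ¬ (x ∧ y)) ≤ ¬ x
    y⊙¬x∧y≤¬x = ⊙¬-transfer (∧-greatest x⊙y≤y x⊙y≤x)

  excluded-middle⇒idempotent : ∀ {x} → F (x ∨ ¬ x) → IsIdempotentMod A F x
  excluded-middle⇒idempotent {x} x∨¬x∈F =
    ∼-intro (⇒∈F x⊙y≤x)
            (up-closed x∨¬x∈F (⇒-intro (⊙-∨-cases ≤-refl
                                          (≤-trans (≤-reflexive (⊙-comm (¬ x) x))
                                                   (≤-trans x⊙¬x≤𝟘 (𝟘-least _))))))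

  excluded-middle⇒∼¬¬ : ∀ {x e} → F (x ∨ ¬ x) → x ∼F e → x ∼F (¬ ¬ e)
  excluded-middle⇒∼¬¬ {x} {e} x∨¬x∈F x∼e =
    ∼-intro (up-closed (∼-elimˡ x∼e) (⇒-monoʳ x≤¬¬x))
            (up-closed (⊙-closed (∼-elimʳ x∼e) x∨¬x∈F) (⇒-intro bound))
    where
    w : Carrier
    w = (e ⇒ x) ⊙ ¬ ¬ e

    ¬x⊙w≤𝟘 : (¬ x ⊙ w) ≤ 𝟘
    ¬x⊙w≤𝟘 = begin
      ¬ x ⊙ ((e ⇒ x) ⊙ ¬ ¬ e)  ≡⟨ sym (⊙-assoc (¬ x) (e ⇒ x) (¬ ¬ e)) ⟩
      (¬ x ⊙ (e ⇒ x)) ⊙ ¬ ¬ e  ≡⟨ cong (_⊙ ¬ ¬ e) (⊙-comm (¬ x) (e ⇒ x)) ⟩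
      ((e ⇒ x) ⊙ ¬ x) ⊙ ¬ ¬ e  ≤⟨ ⊙-monoˡ contraposition ⟩
      ¬ e ⊙ ¬ ¬ e              ≤⟨ x⊙¬x≤𝟘 ⟩
      𝟘                        ∎

    bound : (((e ⇒ x) ⊙ (x ∨ ¬ x)) ⊙ ¬ ¬ e) ≤ x
    bound = begin
      ((e ⇒ x) ⊙ (x ∨ ¬ x)) ⊙ ¬ ¬ e  ≡⟨ cong (_⊙ ¬ ¬ e) (⊙-comm (e ⇒ x) (x ∨ ¬ x)) ⟩
      ((x ∨ ¬ x) ⊙ (e ⇒ x)) ⊙ ¬ ¬ e  ≡⟨ ⊙-assoc (x ∨ ¬ x) (e ⇒ x) (¬ ¬ e) ⟩
      (x ∨ ¬ x) ⊙ w                  ≤⟨ ⊙-∨-cases x⊙y≤x (≤-trans ¬x⊙w≤𝟘 (𝟘-least x)) ⟩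
      x                              ∎

  complemented-descent : HasILP A F → ∀ {x} → IsComplementedMod A F x →
                         Σ Carrier λ e → IsComplemented A e × (x ∼F e)
  complemented-descent ilp {x} x-complemented =
    let x∨¬x∈F = complemented⇒excluded-middle x-complemented
        (e , e-idempotent , x∼e) = Equivalence.to (ilp x) (excluded-middle⇒idempotent x∨¬x∈F)
    in ¬ ¬ e , ¬¬-idempotent-complemented e-idempotent , excluded-middle⇒∼¬¬ x∨¬x∈F x∼e

  ILP⇒BLP : HasILP A F → HasBLP A F
  ILP⇒BLP ilp x = mk⇔ (complemented-descent ilp)
                      (λ { (e , e-complemented , x∼e) → complemented-lift e-complemented x∼e })

corollary5p21 : {a ℓ : Level} (A : BLAlgebra a) →
    ((F : BLAlgebra.Carrier A → Set ℓ) → IsFilter A F →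
      HasILP A F → HasBLP A F)
    × (AlgHasILP A ℓ → AlgHasBLP A ℓ)
corollary5p21 {ℓ = ℓ} A = filterwise , (λ ilp F isFilter → filterwise F isFilter (ilp F isFilter))
  where
  filterwise : (F : BLAlgebra.Carrier A → Set ℓ) → IsFilter A F → HasILP A F → HasBLP A F
  filterwise = FilterFacts.ILP⇒BLP A
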